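{- No graph in $\mathcal{F}_5$ is a contact $B_0$-VPG graph.
   Context: A graph $G$ is contact $B_0$-VPG if there is a collection of nontrivial horizontal and vertical segments on a grid, pairwise interiorly disjoint, in one-to-one correspondence with $V(G)$, such that two vertices are adjacent iff their segments share a grid point that is an endpoint of at least one of them. $\mathcal{F}_5$ is the family of graphs obtained from an induced cycle $v_1\dots v_k$ with $k\ge4$ even by attaching one new triangle to each $v_i$ (the vertices of each new triangle pairwise adjacent, adjacent to $v_i$, and adjacent to nothing else) and adding two further adjacent vertices $s,s'$, each adjacent to $v_1$ and $v_2$ and to nothing else. -}

module Defs where

open import Data.Nat as ℕ using (ℕ; zero; suc)
open import Data.Fin using (Fin; toℕ)
open import Data.Integer as ℤ using (ℤ)
open import Data.Rational as ℚ using (ℚ; _/_)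
open import Data.Product using (Σ; ∃; _×_; _,_)
open import Data.Sum using (_⊎_)
open import Data.Empty using (⊥)
open import Data.Unit using (⊤)
open import Relation.Binary.PropositionalEquality using (_≡_)
open import Relation.Nullary using (¬_)

data Orientation : Set where
  horizontal vertical : Orientation

-- A nontrivial axis-parallel segment on the integer grid.
-- horizontal: points (x , c) with lo ≤ x ≤ hi
-- vertical  : points (c , y) with lo ≤ y ≤ hi
record Seg : Set where
  constructor seg
  field
    orient : Orientation
    c      : ℤ
    lo hi  : ℤ
    lo<hi  : lo ℤ.< hi

GridPoint : Set
GridPoint = ℤ × ℤ

⟦_⟧ : ℤ → ℚ
⟦ z ⟧ = z / 1

OnSeg : GridPoint → Seg → Set
OnSeg (x , y) (seg horizontal c lo hi _) = y ≡ c × lo ℤ.≤ x × x ℤ.≤ hi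
OnSeg (x , y) (seg vertical   c lo hi _) = x ≡ c × lo ℤ.≤ y × y ℤ.≤ hi

IsEndpoint : GridPoint → Seg → Set
IsEndpoint (x , y) (seg horizontal c lo hi _) = y ≡ c × (x ≡ lo ⊎ x ≡ hi)
IsEndpoint (x , y) (seg vertical   c lo hi _) = x ≡ c × (y ≡ lo ⊎ y ≡ hi)

InInterior : ℚ × ℚ → Seg → Set
InInterior (x , y) (seg horizontal c lo hi _) = y ≡ ⟦ c ⟧ × ⟦ lo ⟧ ℚ.< x × x ℚ.< ⟦ hi ⟧
InInterior (x , y) (seg vertical   c lo hi _) = x ≡ ⟦ c ⟧ × ⟦ lo ⟧ ℚ.< y × y ℚ.< ⟦ hi ⟧

InteriorlyDisjoint : Seg → Seg → Set
InteriorlyDisjoint s t = ∀ p → InInterior p s → InInterior p t → ⊥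

Touch : Seg → Seg → Set
Touch s t = ∃ λ p → OnSeg p s × OnSeg p t × (IsEndpoint p s ⊎ IsEndpoint p t)

record ContactB0VPGRep (V : Set) (E : V → V → Set) : Set₁ where
  field
    segOf    : V → Seg
    disjoint : ∀ u v → ¬ u ≡ v → InteriorlyDisjoint (segOf u) (segOf v)
    adj→touch : ∀ u v → ¬ u ≡ v → E u v → Touch (segOf u) (segOf v)
    touch→adj : ∀ u v → ¬ u ≡ v → Touch (segOf u) (segOf v) → E u v

IsContactB0VPG : (V : Set) → (V → V → Set) → Set₁
IsContactB0VPG V E = ContactB0VPGRep V E

-- vertices: cycle vertices v_i (i : Fin k), triangle vertices t_{i,a}
-- (the triangle attached to v_i, a : Fin 3), and s, s'
data F5V (k : ℕ) : Set where
  cyc : Fin k → F5V k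
  tri : Fin k → Fin 3 → F5V k
  s s' : F5V k

-- consecutive on the cycle v_0 … v_{k-1} (0-based indices)
CycAdj : (k : ℕ) → Fin k → Fin k → Set
CycAdj k i j =
    suc (toℕ i) ≡ toℕ j
  ⊎ suc (toℕ j) ≡ toℕ i
  ⊎ (toℕ i ≡ 0 × suc (toℕ j) ≡ k)
  ⊎ (toℕ j ≡ 0 × suc (toℕ i) ≡ k)

-- v_1 and v_2 of the paper (indices 0 and 1 here)
IsV1orV2 : {k : ℕ} → Fin k → Set
IsV1orV2 i = toℕ i ≡ 0 ⊎ toℕ i ≡ 1

F5Adj : (k : ℕ) → F5V k → F5V k → Set
F5Adj k (cyc i)   (cyc j)   = CycAdj k i j
F5Adj k (cyc i)   (tri j b) = i ≡ j
F5Adj k (cyc i)   s         = IsV1orV2 i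
F5Adj k (cyc i)   s'        = IsV1orV2 i
F5Adj k (tri i a) (cyc j)   = i ≡ j
F5Adj k (tri i a) (tri j b) = i ≡ j × ¬ a ≡ b
F5Adj k (tri i a) s         = ⊥
F5Adj k (tri i a) s'        = ⊥
F5Adj k s         (cyc j)   = IsV1orV2 j
F5Adj k s         (tri j b) = ⊥
F5Adj k s         s         = ⊥
F5Adj k s         s'        = ⊤
F5Adj k s'        (cyc j)   = IsV1orV2 j
F5Adj k s'        (tri j b) = ⊥
F5Adj k s'        s         = ⊤
F5Adj k s'        s'        = ⊥

-- Every grid point has four unit grid edges around it; interiorly disjoint
-- segments through the point cover pairwise different ones, and a segment
-- passing through it covers two.  Hence pairwise touching, interiorly disjoint
-- segments share a point, and for a K₄ that point is an endpoint of all four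
-- segments and lies on no other segment.  Each cycle vertex v_i forms a K₄ with
-- its triangle, so v_i keeps exactly one free endpoint; v₁, v₂, s, s′ (cycle
-- indices 0 and 1) form a K₄ whose point, the hub, takes the free endpoints of
-- v₁ and v₂.  Each cycle edge needs the free endpoint of one of its ends to lie
-- on the other end, and no free endpoint serves two edges, as the two
-- neighbours would then touch.  Along the path v₂ v₃ … v_k v₁ every edge is
-- therefore served by its later vertex, so the last one by v₁: impossible.

module Submission where

open import Defs
open import Data.Nat as ℕ using (ℕ; zero; suc; z≤n; s≤s; _≤_)
import Data.Nat.Properties as ℕP
import Data.Nat.DivMod as DivMod
open DivMod using (_mod_)
open import Data.Nat.Divisibility using (_∣_)
open import Data.Fin as Fin using (Fin; toℕ)
import Data.Fin.Properties as FinP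
open import Data.Integer as ℤ using (ℤ)
import Data.Integer.Properties as ℤP
open import Data.Rational as ℚ using (ℚ; mkℚ)
import Data.Rational.Properties as ℚP
import Data.Nat.Coprimality as Coprimality
open import Data.Vec using (Vec; []; _∷_; lookup; map)
open import Data.Vec.Relation.Unary.All as All using (All; []; _∷_)
import Data.Vec.Relation.Unary.All.Properties as AllP
open import Data.Vec.Relation.Unary.AllPairs as AllPairs using (AllPairs; []; _∷_)
import Data.Vec.Relation.Unary.AllPairs.Properties as AllPairsP
open import Data.Vec.Relation.Unary.Unique.Propositional using (Unique)
open import Data.Vec.Relation.Unary.Unique.Propositional.Properties using (lookup-injective)
open import Data.Product using (∃; _×_; _,_; proj₁; proj₂)
open import Data.Product.Properties using (≡-dec)
open import Data.Sum as Sum using (_⊎_; inj₁; inj₂)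
open import Data.Empty using (⊥; ⊥-elim)
open import Data.Unit using (tt)
open import Function using (_∘_)
open import Relation.Nullary using (¬_; Dec; yes; no)
open import Relation.Binary using (tri<; tri≈; tri>)
open import Relation.Binary.PropositionalEquality

⟦⟧≡mkℚ : ∀ z → ⟦ z ⟧ ≡ mkℚ z 0 (Coprimality.sym (Coprimality.1-coprimeTo _))
⟦⟧≡mkℚ z = ℚP.↥p/↧p≡p (mkℚ z 0 _)

⟦⟧-mono-< : ∀ {a b} → a ℤ.< b → ⟦ a ⟧ ℚ.< ⟦ b ⟧
⟦⟧-mono-< {a} {b} a<b rewrite ⟦⟧≡mkℚ a | ⟦⟧≡mkℚ b =
  ℚ.*<* (subst₂ ℤ._<_ (sym (ℤP.*-identityʳ a)) (sym (ℤP.*-identityʳ b)) a<b)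

⟦⟧-mono-≤ : ∀ {a b} → a ℤ.≤ b → ⟦ a ⟧ ℚ.≤ ⟦ b ⟧
⟦⟧-mono-≤ {a} {b} a≤b rewrite ⟦⟧≡mkℚ a | ⟦⟧≡mkℚ b =
  ℚ.*≤* (subst₂ ℤ._≤_ (sym (ℤP.*-identityʳ a)) (sym (ℤP.*-identityʳ b)) a≤b)

UnitIn : ℤ → ℤ → ℤ → Set
UnitIn lo hi e = lo ℤ.≤ e × ℤ.suc e ℤ.≤ hi

unitIn-right : ∀ {lo hi x} → lo ℤ.≤ x → x ℤ.< hi → UnitIn lo hi x
unitIn-right lo≤x x<hi = lo≤x , ℤP.i<j⇒suc[i]≤j x<hi

unitIn-left : ∀ {lo hi x} → lo ℤ.< x → x ℤ.≤ hi → UnitIn lo hi (ℤ.pred x)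
unitIn-left {x = x} lo<x x≤hi = ℤP.i<j⇒i≤pred[j] lo<x , subst (ℤ._≤ _) (sym (ℤP.suc-pred x)) x≤hi

unitIn-either-side : ∀ {lo hi x} → lo ℤ.< hi → lo ℤ.≤ x → x ℤ.≤ hi →
                     UnitIn lo hi x ⊎ UnitIn lo hi (ℤ.pred x)
unitIn-either-side {hi = hi} {x} lo<hi lo≤x x≤hi with x ℤP.<? hi
... | yes x<hi = inj₁ (unitIn-right lo≤x x<hi)
... | no  x≮hi = inj₂ (unitIn-left (ℤP.<-≤-trans lo<hi (ℤP.≮⇒≥ x≮hi)) x≤hi)

unitIn-end-or-both-sides : ∀ {lo hi x} → lo ℤ.≤ x → x ℤ.≤ hi →
                           (x ≡ lo ⊎ x ≡ hi) ⊎ (UnitIn lo hi x × UnitIn lo hi (ℤ.pred x))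
unitIn-end-or-both-sides {lo} {hi} {x} lo≤x x≤hi with x ℤ.≟ lo | x ℤ.≟ hi
... | yes x≡lo | _        = inj₁ (inj₁ x≡lo)
... | no  _    | yes x≡hi = inj₁ (inj₂ x≡hi)
... | no  x≢lo | no  x≢hi =
  inj₂ (unitIn-right lo≤x (ℤP.≤∧≢⇒< x≤hi x≢hi) , unitIn-left (ℤP.≤∧≢⇒< lo≤x (x≢lo ∘ sym)) x≤hi)

unitIn-toward : ∀ {lo hi x x′} → lo ℤ.≤ x → x ℤ.< x′ → x′ ℤ.≤ hi → UnitIn lo hi x
unitIn-toward lo≤x x<x′ x′≤hi = unitIn-right lo≤x (ℤP.<-≤-trans x<x′ x′≤hi)

unitDense : ∀ e → ∃ λ m → ⟦ e ⟧ ℚ.< m × m ℚ.< ⟦ ℤ.suc e ⟧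
unitDense e = ℚP.<-dense (⟦⟧-mono-< {e} (ℤP.suc[i]≤j⇒i<j ℤP.≤-refl))

innerPoint : ℤ → ℚ
innerPoint e = proj₁ (unitDense e)

innerPoint-inside : ∀ {lo hi e} → UnitIn lo hi e → ⟦ lo ⟧ ℚ.< innerPoint e × innerPoint e ℚ.< ⟦ hi ⟧
innerPoint-inside {e = e} (lo≤e , 1+e≤hi) =
  ℚP.≤-<-trans (⟦⟧-mono-≤ lo≤e) (proj₁ between) , ℚP.<-≤-trans (proj₂ between) (⟦⟧-mono-≤ 1+e≤hi)
  where between = proj₂ (unitDense e)

data Dir : Set where
  east west north south : Dir

opposite : Dir → Dir
opposite east  = west
opposite west  = east
opposite north = south
opposite south = north

opposite-≢ : ∀ d → d ≢ opposite d
opposite-≢ east  ()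
opposite-≢ west  ()
opposite-≢ north ()
opposite-≢ south ()

Occupies : Seg → GridPoint → Dir → Set
Occupies (seg horizontal c lo hi _) (x , y) east  = y ≡ c × UnitIn lo hi x
Occupies (seg horizontal c lo hi _) (x , y) west  = y ≡ c × UnitIn lo hi (ℤ.pred x)
Occupies (seg vertical   c lo hi _) (x , y) north = x ≡ c × UnitIn lo hi y
Occupies (seg vertical   c lo hi _) (x , y) south = x ≡ c × UnitIn lo hi (ℤ.pred y)
Occupies (seg horizontal _ _  _  _) _       north = ⊥
Occupies (seg horizontal _ _  _  _) _       south = ⊥
Occupies (seg vertical   _ _  _  _) _       east  = ⊥
Occupies (seg vertical   _ _  _  _) _       west  = ⊥

edgeInnerPoint : GridPoint → Dir → ℚ × ℚ
edgeInnerPoint (x , y) east  = innerPoint x , ⟦ y ⟧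
edgeInnerPoint (x , y) west  = innerPoint (ℤ.pred x) , ⟦ y ⟧
edgeInnerPoint (x , y) north = ⟦ x ⟧ , innerPoint y
edgeInnerPoint (x , y) south = ⟦ x ⟧ , innerPoint (ℤ.pred y)

occupies⇒interior : ∀ S p d → Occupies S p d → InInterior (edgeInnerPoint p d) S
occupies⇒interior (seg horizontal _ _ _ _) _ east  (refl , e) = refl , innerPoint-inside e
occupies⇒interior (seg horizontal _ _ _ _) _ west  (refl , e) = refl , innerPoint-inside e
occupies⇒interior (seg vertical   _ _ _ _) _ north (refl , e) = refl , innerPoint-inside e
occupies⇒interior (seg vertical   _ _ _ _) _ south (refl , e) = refl , innerPoint-inside e

co-occupation-impossible : ∀ S T p d → InteriorlyDisjoint S T → Occupies S p d → Occupies T p d → ⊥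
co-occupation-impossible S T p d S∩T=∅ oS oT =
  S∩T=∅ (edgeInnerPoint p d) (occupies⇒interior S p d oS) (occupies⇒interior T p d oT)

disjoint⇒directions-≢ : ∀ {S T p d e} → InteriorlyDisjoint S T →
                         Occupies S p d → Occupies T p e → d ≢ e
disjoint⇒directions-≢ {S} {T} {p} {d} S∩T=∅ oS oT refl = co-occupation-impossible S T p d S∩T=∅ oS oT

onSeg⇒occupies : ∀ S p → OnSeg p S → ∃ (Occupies S p)
onSeg⇒occupies (seg horizontal _ _ _ lo<hi) _ (refl , lo≤x , x≤hi) with unitIn-either-side lo<hi lo≤x x≤hi
... | inj₁ u = east , refl , u
... | inj₂ u = west , refl , u
onSeg⇒occupies (seg vertical _ _ _ lo<hi) _ (refl , lo≤y , y≤hi) with unitIn-either-side lo<hi lo≤y y≤hi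
... | inj₁ u = north , refl , u
... | inj₂ u = south , refl , u

endpoint-or-occupies-opposite : ∀ S p → OnSeg p S →
  IsEndpoint p S ⊎ ∃ λ d → Occupies S p d × Occupies S p (opposite d)
endpoint-or-occupies-opposite (seg horizontal _ _ _ _) _ (refl , lo≤x , x≤hi) with unitIn-end-or-both-sides lo≤x x≤hi
... | inj₁ end       = inj₁ (refl , end)
... | inj₂ (u , u′) = inj₂ (east , (refl , u) , (refl , u′))
endpoint-or-occupies-opposite (seg vertical _ _ _ _) _ (refl , lo≤y , y≤hi) with unitIn-end-or-both-sides lo≤y y≤hi
... | inj₁ end       = inj₁ (refl , end)
... | inj₂ (u , u′) = inj₂ (north , (refl , u) , (refl , u′))

endpoint⇒onSeg : ∀ {S p} → IsEndpoint p S → OnSeg p S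
endpoint⇒onSeg {seg horizontal _ _ _ lo<hi} (refl , inj₁ refl) = refl , ℤP.≤-refl , ℤP.<⇒≤ lo<hi
endpoint⇒onSeg {seg horizontal _ _ _ lo<hi} (refl , inj₂ refl) = refl , ℤP.<⇒≤ lo<hi , ℤP.≤-refl
endpoint⇒onSeg {seg vertical   _ _ _ lo<hi} (refl , inj₁ refl) = refl , ℤP.≤-refl , ℤP.<⇒≤ lo<hi
endpoint⇒onSeg {seg vertical   _ _ _ lo<hi} (refl , inj₂ refl) = refl , ℤP.<⇒≤ lo<hi , ℤP.≤-refl

two-choices⇒≡ : ∀ {A : Set} {a b x y z : A} → x ≡ a ⊎ x ≡ b → y ≡ a ⊎ y ≡ b → z ≡ a ⊎ z ≡ b →
             x ≢ z → y ≢ z → x ≡ y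
two-choices⇒≡ (inj₁ refl) (inj₁ refl) _          _   _   = refl
two-choices⇒≡ (inj₂ refl) (inj₂ refl) _          _   _   = refl
two-choices⇒≡ (inj₁ refl) (inj₂ refl) (inj₁ refl) x≢z _   = ⊥-elim (x≢z refl)
two-choices⇒≡ (inj₁ refl) (inj₂ refl) (inj₂ refl) _   y≢z = ⊥-elim (y≢z refl)
two-choices⇒≡ (inj₂ refl) (inj₁ refl) (inj₁ refl) _   y≢z = ⊥-elim (y≢z refl)
two-choices⇒≡ (inj₂ refl) (inj₁ refl) (inj₂ refl) x≢z _   = ⊥-elim (x≢z refl)

endpoint-other-than-unique : ∀ {S p p′ q} → IsEndpoint p S → IsEndpoint p′ S → IsEndpoint q S →
                      p ≢ q → p′ ≢ q → p ≡ p′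
endpoint-other-than-unique {seg horizontal _ _ _ _} (refl , x) (refl , x′) (refl , u) p≢q p′≢q =
  cong (_, _) (two-choices⇒≡ x x′ u (p≢q ∘ cong (_, _)) (p′≢q ∘ cong (_, _)))
endpoint-other-than-unique {seg vertical _ _ _ _} (refl , y) (refl , y′) (refl , v) p≢q p′≢q =
  cong (_ ,_) (two-choices⇒≡ y y′ v (p≢q ∘ cong (_ ,_)) (p′≢q ∘ cong (_ ,_)))

dirIndex : Dir → Fin 4
dirIndex east  = Fin.zero
dirIndex west  = Fin.suc Fin.zero
dirIndex north = Fin.suc (Fin.suc Fin.zero)
dirIndex south = Fin.suc (Fin.suc (Fin.suc Fin.zero))

indexDir : Fin 4 → Dir
indexDir Fin.zero                               = east
indexDir (Fin.suc Fin.zero)                     = west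
indexDir (Fin.suc (Fin.suc Fin.zero))           = north
indexDir (Fin.suc (Fin.suc (Fin.suc Fin.zero))) = south

indexDir-dirIndex : ∀ d → indexDir (dirIndex d) ≡ d
indexDir-dirIndex east  = refl
indexDir-dirIndex west  = refl
indexDir-dirIndex north = refl
indexDir-dirIndex south = refl

dirIndex-injective : ∀ {d e} → dirIndex d ≡ dirIndex e → d ≡ e
dirIndex-injective {d} {e} eq =
  trans (sym (indexDir-dirIndex d)) (trans (cong indexDir eq) (indexDir-dirIndex e))

unique-directions-≤4 : ∀ {n} {ds : Vec Dir n} → Unique ds → n ≤ 4
unique-directions-≤4 {ds = ds} unique =
  FinP.injective⇒≤ (lookup-injective unique _ _ ∘ dirIndex-injective {lookup ds _} {lookup ds _})

no-five-distinct-directions : ∀ {a b c d e : Dir} → ¬ Unique (a ∷ b ∷ c ∷ d ∷ e ∷ [])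
no-five-distinct-directions = ℕP.<-irrefl refl ∘ unique-directions-≤4

module _ {p : GridPoint} where

  directionsAt : ∀ {n} {Ss : Vec Seg n} → All (OnSeg p) Ss → Vec Dir n
  directionsAt [] = []
  directionsAt {Ss = S ∷ _} (p∈S ∷ ps) = proj₁ (onSeg⇒occupies S p p∈S) ∷ directionsAt ps

  directionsAt-avoid : ∀ {n S d} {Ss : Vec Seg n} → Occupies S p d → All (InteriorlyDisjoint S) Ss →
                       (ps : All (OnSeg p) Ss) → All (d ≢_) (directionsAt ps)
  directionsAt-avoid occ [] [] = []
  directionsAt-avoid {Ss = T ∷ _} occ (S∩T=∅ ∷ disj) (p∈T ∷ ps) =
    disjoint⇒directions-≢ S∩T=∅ occ (proj₂ (onSeg⇒occupies T p p∈T)) ∷ directionsAt-avoid occ disj ps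

  directionsAt-unique : ∀ {n} {Ss : Vec Seg n} → AllPairs InteriorlyDisjoint Ss →
                        (ps : All (OnSeg p) Ss) → Unique (directionsAt ps)
  directionsAt-unique [] [] = []
  directionsAt-unique {Ss = S ∷ _} (disj ∷ disjs) (p∈S ∷ ps) =
    directionsAt-avoid (proj₂ (onSeg⇒occupies S p p∈S)) disj ps ∷ directionsAt-unique disjs ps

  disjoint-through-point-≤4 : ∀ {n} {Ss : Vec Seg n} → AllPairs InteriorlyDisjoint Ss → All (OnSeg p) Ss → n ≤ 4
  disjoint-through-point-≤4 disjs ps = unique-directions-≤4 (directionsAt-unique disjs ps)

  three-disjoint-through-point⇒endpoint : ∀ {n S} {Ss : Vec Seg n} → 3 ≤ n → OnSeg p S →
    All (InteriorlyDisjoint S) Ss → AllPairs InteriorlyDisjoint Ss → All (OnSeg p) Ss → IsEndpoint p S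
  three-disjoint-through-point⇒endpoint {S = S} 3≤n p∈S disj disjs ps
    with endpoint-or-occupies-opposite S p p∈S
  ... | inj₁ p∈∂S = p∈∂S
  ... | inj₂ (d , occ , occ′) = ⊥-elim (ℕP.≤⇒≯ (unique-directions-≤4
    ((opposite-≢ d ∷ directionsAt-avoid occ disj ps) ∷ directionsAt-avoid occ′ disj ps ∷ directionsAt-unique disjs ps))
    (s≤s (s≤s 3≤n)))

  -- two segments through p in their interiors already use all four directions at p
  endpoint-of-one : ∀ {S T W} → InteriorlyDisjoint S T → InteriorlyDisjoint S W → InteriorlyDisjoint T W →
    OnSeg p S → OnSeg p T → OnSeg p W → IsEndpoint p S ⊎ IsEndpoint p T
  endpoint-of-one {S} {T} {W} S∩T=∅ S∩W=∅ T∩W=∅ p∈S p∈T p∈W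
    with endpoint-or-occupies-opposite S p p∈S | endpoint-or-occupies-opposite T p p∈T | onSeg⇒occupies W p p∈W
  ... | inj₁ p∈∂S | _ | _ = inj₁ p∈∂S
  ... | inj₂ _ | inj₁ p∈∂T | _ = inj₂ p∈∂T
  ... | inj₂ (d , oS , oS′) | inj₂ (e , oT , oT′) | f , oW = ⊥-elim (no-five-distinct-directions
    ( (opposite-≢ d ∷ ST oS oT ∷ ST oS oT′ ∷ SW oS oW ∷ [])
    ∷ (ST oS′ oT ∷ ST oS′ oT′ ∷ SW oS′ oW ∷ [])
    ∷ (opposite-≢ e ∷ TW oT oW ∷ [])
    ∷ (TW oT′ oW ∷ [])
    ∷ [] ∷ []))
    where
    ST : ∀ {a b} → Occupies S p a → Occupies T p b → a ≢ b
    ST = disjoint⇒directions-≢ S∩T=∅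
    SW : ∀ {a b} → Occupies S p a → Occupies W p b → a ≢ b
    SW = disjoint⇒directions-≢ S∩W=∅
    TW : ∀ {a b} → Occupies T p a → Occupies W p b → a ≢ b
    TW = disjoint⇒directions-≢ T∩W=∅

common-point-unique : ∀ {S T p q} → InteriorlyDisjoint S T →
  OnSeg p S → OnSeg p T → OnSeg q S → OnSeg q T → p ≡ q
common-point-unique {S@(seg horizontal _ _ _ _)} {T@(seg horizontal _ _ _ _)} {p@(x , _)} {q@(x′ , _)} S∩T=∅
  (refl , lS , hS) (refl , lT , hT) (refl , lS′ , hS′) (refl , lT′ , hT′) with ℤP.<-cmp x x′
... | tri< x<x′ _ _ = ⊥-elim (co-occupation-impossible S T p east S∩T=∅
      (refl , unitIn-toward lS x<x′ hS′) (refl , unitIn-toward lT x<x′ hT′))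
... | tri≈ _ refl _ = refl
... | tri> _ _ x′<x = ⊥-elim (co-occupation-impossible S T q east S∩T=∅
      (refl , unitIn-toward lS′ x′<x hS) (refl , unitIn-toward lT′ x′<x hT))
common-point-unique {S@(seg vertical _ _ _ _)} {T@(seg vertical _ _ _ _)} {p@(_ , y)} {q@(_ , y′)} S∩T=∅
  (refl , lS , hS) (refl , lT , hT) (refl , lS′ , hS′) (refl , lT′ , hT′) with ℤP.<-cmp y y′
... | tri< y<y′ _ _ = ⊥-elim (co-occupation-impossible S T p north S∩T=∅
      (refl , unitIn-toward lS y<y′ hS′) (refl , unitIn-toward lT y<y′ hT′))
... | tri≈ _ refl _ = refl
... | tri> _ _ y′<y = ⊥-elim (co-occupation-impossible S T q north S∩T=∅
      (refl , unitIn-toward lS′ y′<y hS) (refl , unitIn-toward lT′ y′<y hT))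
common-point-unique {seg horizontal _ _ _ _} {seg vertical _ _ _ _} _ (refl , _) (refl , _) (refl , _) (refl , _) = refl
common-point-unique {seg vertical _ _ _ _} {seg horizontal _ _ _ _} _ (refl , _) (refl , _) (refl , _) (refl , _) = refl

least-of-three : ∀ {x y z} → x ≢ y → x ≢ z → y ≢ z →
  (x ℤ.< y × x ℤ.< z) ⊎ (y ℤ.< x × y ℤ.< z) ⊎ (z ℤ.< x × z ℤ.< y)
least-of-three {x} {y} {z} x≢y x≢z y≢z with ℤP.<-cmp x y | ℤP.<-cmp x z | ℤP.<-cmp y z
... | tri≈ _ x≡y _ | _             | _             = ⊥-elim (x≢y x≡y)
... | _            | tri≈ _ x≡z _  | _             = ⊥-elim (x≢z x≡z)
... | _            | _             | tri≈ _ y≡z _  = ⊥-elim (y≢z y≡z)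
... | tri< x<y _ _ | tri< x<z _ _  | _             = inj₁ (x<y , x<z)
... | tri< x<y _ _ | tri> _ _ z<x  | _             = inj₂ (inj₂ (z<x , ℤP.<-trans z<x x<y))
... | tri> _ _ y<x | _             | tri< y<z _ _  = inj₂ (inj₁ (y<x , y<z))
... | tri> _ _ y<x | _             | tri> _ _ z<y  = inj₂ (inj₂ (ℤP.<-trans z<y y<x , z<y))

distinct-meeting-points-impossible : ∀ A B C {p₁ p₂ p₃} →
  InteriorlyDisjoint A B → InteriorlyDisjoint A C → InteriorlyDisjoint B C →
  OnSeg p₁ A → OnSeg p₁ B → OnSeg p₂ A → OnSeg p₂ C → OnSeg p₃ B → OnSeg p₃ C →
  p₁ ≢ p₂ → p₁ ≢ p₃ → p₂ ≢ p₃ → ⊥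
distinct-meeting-points-impossible
  A@(seg horizontal _ _ _ _) B@(seg horizontal _ _ _ _) C@(seg horizontal _ _ _ _) {p₁} {p₂} {p₃} AB AC BC
  (refl , l₁A , h₁A) (refl , l₁B , h₁B) (refl , l₂A , h₂A) (refl , l₂C , h₂C) (refl , l₃B , h₃B) (refl , l₃C , h₃C)
  p₁≢p₂ p₁≢p₃ p₂≢p₃
  with least-of-three (p₁≢p₂ ∘ cong (_, _)) (p₁≢p₃ ∘ cong (_, _)) (p₂≢p₃ ∘ cong (_, _))
... | inj₁ (x₁<x₂ , x₁<x₃) = co-occupation-impossible A B p₁ east AB
      (refl , unitIn-toward l₁A x₁<x₂ h₂A) (refl , unitIn-toward l₁B x₁<x₃ h₃B)
... | inj₂ (inj₁ (x₂<x₁ , x₂<x₃)) = co-occupation-impossible A C p₂ east AC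
      (refl , unitIn-toward l₂A x₂<x₁ h₁A) (refl , unitIn-toward l₂C x₂<x₃ h₃C)
... | inj₂ (inj₂ (x₃<x₁ , x₃<x₂)) = co-occupation-impossible B C p₃ east BC
      (refl , unitIn-toward l₃B x₃<x₁ h₁B) (refl , unitIn-toward l₃C x₃<x₂ h₂C)
distinct-meeting-points-impossible
  A@(seg vertical _ _ _ _) B@(seg vertical _ _ _ _) C@(seg vertical _ _ _ _) {p₁} {p₂} {p₃} AB AC BC
  (refl , l₁A , h₁A) (refl , l₁B , h₁B) (refl , l₂A , h₂A) (refl , l₂C , h₂C) (refl , l₃B , h₃B) (refl , l₃C , h₃C)
  p₁≢p₂ p₁≢p₃ p₂≢p₃
  with least-of-three (p₁≢p₂ ∘ cong (_ ,_)) (p₁≢p₃ ∘ cong (_ ,_)) (p₂≢p₃ ∘ cong (_ ,_))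
... | inj₁ (y₁<y₂ , y₁<y₃) = co-occupation-impossible A B p₁ north AB
      (refl , unitIn-toward l₁A y₁<y₂ h₂A) (refl , unitIn-toward l₁B y₁<y₃ h₃B)
... | inj₂ (inj₁ (y₂<y₁ , y₂<y₃)) = co-occupation-impossible A C p₂ north AC
      (refl , unitIn-toward l₂A y₂<y₁ h₁A) (refl , unitIn-toward l₂C y₂<y₃ h₃C)
... | inj₂ (inj₂ (y₃<y₁ , y₃<y₂)) = co-occupation-impossible B C p₃ north BC
      (refl , unitIn-toward l₃B y₃<y₁ h₁B) (refl , unitIn-toward l₃C y₃<y₂ h₂C)
distinct-meeting-points-impossible (seg horizontal _ _ _ _) (seg horizontal _ _ _ _) (seg vertical _ _ _ _)
  _ _ _ (refl , _) (refl , _) (refl , _) (refl , _) (refl , _) (refl , _) _ _ p₂≢p₃ = p₂≢p₃ refl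
distinct-meeting-points-impossible (seg vertical _ _ _ _) (seg vertical _ _ _ _) (seg horizontal _ _ _ _)
  _ _ _ (refl , _) (refl , _) (refl , _) (refl , _) (refl , _) (refl , _) _ _ p₂≢p₃ = p₂≢p₃ refl
distinct-meeting-points-impossible (seg horizontal _ _ _ _) (seg vertical _ _ _ _) (seg horizontal _ _ _ _)
  _ _ _ (refl , _) (refl , _) (refl , _) (refl , _) (refl , _) (refl , _) _ p₁≢p₃ _ = p₁≢p₃ refl
distinct-meeting-points-impossible (seg vertical _ _ _ _) (seg horizontal _ _ _ _) (seg vertical _ _ _ _)
  _ _ _ (refl , _) (refl , _) (refl , _) (refl , _) (refl , _) (refl , _) _ p₁≢p₃ _ = p₁≢p₃ refl
distinct-meeting-points-impossible (seg horizontal _ _ _ _) (seg vertical _ _ _ _) (seg vertical _ _ _ _)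
  _ _ _ (refl , _) (refl , _) (refl , _) (refl , _) (refl , _) (refl , _) p₁≢p₂ _ _ = p₁≢p₂ refl
distinct-meeting-points-impossible (seg vertical _ _ _ _) (seg horizontal _ _ _ _) (seg horizontal _ _ _ _)
  _ _ _ (refl , _) (refl , _) (refl , _) (refl , _) (refl , _) (refl , _) p₁≢p₂ _ _ = p₁≢p₂ refl

Meet : Seg → Seg → Set
Meet S T = ∃ λ p → OnSeg p S × OnSeg p T

InContact : Seg → Seg → Set
InContact S T = InteriorlyDisjoint S T × Meet S T

_≟ᵖ_ : (p q : GridPoint) → Dec (p ≡ q)
_≟ᵖ_ = ≡-dec ℤ._≟_ ℤ._≟_

pairwise-contact⇒common-point : ∀ {A B C} → InContact A B → InContact A C → InContact B C →
  ∃ λ p → OnSeg p A × OnSeg p B × OnSeg p C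
pairwise-contact⇒common-point {A} {B} {C}
  (AB , p₁ , p₁∈A , p₁∈B) (AC , p₂ , p₂∈A , p₂∈C) (BC , p₃ , p₃∈B , p₃∈C)
  with p₁ ≟ᵖ p₂ | p₁ ≟ᵖ p₃ | p₂ ≟ᵖ p₃
... | yes refl | _        | _        = p₁ , p₁∈A , p₁∈B , p₂∈C
... | no  _    | yes refl | _        = p₁ , p₁∈A , p₁∈B , p₃∈C
... | no  _    | no  _    | yes refl = p₂ , p₂∈A , p₃∈B , p₂∈C
... | no p₁≢p₂ | no p₁≢p₃ | no p₂≢p₃ = ⊥-elim
  (distinct-meeting-points-impossible A B C AB AC BC p₁∈A p₁∈B p₂∈A p₂∈C p₃∈B p₃∈C p₁≢p₂ p₁≢p₃ p₂≢p₃)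

pairwise-contact⇒all-through-point : ∀ {n S T} {Ss : Vec Seg n} → AllPairs InContact (S ∷ T ∷ Ss) →
  ∃ λ p → All (OnSeg p) (S ∷ T ∷ Ss)
pairwise-contact⇒all-through-point {Ss = []} (((_ , p , p∈S , p∈T) ∷ []) ∷ [] ∷ []) = p , p∈S ∷ p∈T ∷ []
pairwise-contact⇒all-through-point {Ss = U ∷ _} ((ST ∷ SU ∷ _) ∷ rest@((TU ∷ _) ∷ _))
  with pairwise-contact⇒common-point ST SU TU | pairwise-contact⇒all-through-point rest
... | p , p∈S , p∈T , p∈U | q , q∈T ∷ q∈U ∷ q∈Us
  rewrite common-point-unique (proj₁ TU) p∈T p∈U q∈T q∈U = q , p∈S ∷ q∈T ∷ q∈U ∷ q∈Us

touch⇒meet : ∀ {S T} → Touch S T → Meet S T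
touch⇒meet (p , p∈S , p∈T , _) = p , p∈S , p∈T

module Representation {V : Set} {E : V → V → Set} (rep : ContactB0VPGRep V E) where
  open ContactB0VPGRep rep

  Clique : ∀ {n} → Vec V n → Set
  Clique = AllPairs (λ u v → u ≢ v × E u v)

  distinct⇒disjoint : ∀ {n} {vs : Vec V n} → AllPairs _≢_ vs → AllPairs InteriorlyDisjoint (map segOf vs)
  distinct⇒disjoint = AllPairsP.map⁺ ∘ AllPairs.map (disjoint _ _)

  clique⇒all-through-point : ∀ {n a b} {vs : Vec V n} → Clique (a ∷ b ∷ vs) →
    ∃ λ p → All (OnSeg p) (map segOf (a ∷ b ∷ vs))
  clique⇒all-through-point =
    pairwise-contact⇒all-through-point ∘ AllPairsP.map⁺ ∘ AllPairs.map λ (u≢v , uv) →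
      disjoint _ _ u≢v , touch⇒meet (adj→touch _ _ u≢v uv)

  clique-point-endpoint : ∀ {n a p} {vs : Vec V n} → Clique (a ∷ vs) → 3 ≤ n →
    All (OnSeg p) (map segOf (a ∷ vs)) → IsEndpoint p (segOf a)
  clique-point-endpoint (a-vs ∷ clique) 3≤n (p∈a ∷ ps) = three-disjoint-through-point⇒endpoint 3≤n p∈a
    (AllP.map⁺ (All.map (disjoint _ _ ∘ proj₁) a-vs)) (distinct⇒disjoint (AllPairs.map proj₁ clique)) ps

  clique-point-private : ∀ {n w p} {vs : Vec V n} → AllPairs _≢_ vs → 4 ≤ n →
    All (OnSeg p) (map segOf vs) → All (w ≢_) vs → ¬ OnSeg p (segOf w)
  clique-point-private distinct 4≤n ps w∉vs p∈w =
    ℕP.≤⇒≯ (disjoint-through-point-≤4 (distinct⇒disjoint (w∉vs ∷ distinct)) (p∈w ∷ ps)) (s≤s 4≤n)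

module _ (_⇝_ : ℕ → ℕ → Set) {n : ℕ}
         (covered : ∀ i → i ℕ.< n → i ⇝ suc i ⊎ suc i ⇝ i)
         (one-way : ∀ i → suc i ℕ.< n → suc i ⇝ i → ¬ suc i ⇝ suc (suc i))
         (¬0⇝1 : ¬ 0 ⇝ 1) where

  edges-point-backward : ∀ i → i ℕ.< n → suc i ⇝ i
  edges-point-backward zero 0<n with covered 0 0<n
  ... | inj₁ 0⇝1 = ⊥-elim (¬0⇝1 0⇝1)
  ... | inj₂ 1⇝0 = 1⇝0
  edges-point-backward (suc i) 1+i<n with covered (suc i) 1+i<n
  ... | inj₁ forward  = ⊥-elim (one-way i 1+i<n (edges-point-backward i (ℕP.<-trans (ℕP.n<1+n i) 1+i<n)) forward)
  ... | inj₂ backward = backward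

-- CycAdj k i j unfolds to Consecutive k (toℕ i) (toℕ j)
Consecutive : ℕ → ℕ → ℕ → Set
Consecutive k a b = suc a ≡ b ⊎ suc b ≡ a ⊎ (a ≡ 0 × suc b ≡ k) ⊎ (b ≡ 0 × suc a ≡ k)

consecutive-irreflexive : ∀ {n a} → ¬ Consecutive (suc (suc n)) a a
consecutive-irreflexive (inj₁ 1+a≡a)               = ℕP.1+n≢n 1+a≡a
consecutive-irreflexive (inj₂ (inj₁ 1+a≡a))        = ℕP.1+n≢n 1+a≡a
consecutive-irreflexive (inj₂ (inj₂ (inj₁ (refl , ()))))
consecutive-irreflexive (inj₂ (inj₂ (inj₂ (refl , ()))))

module Cycle (m : ℕ) where

  k : ℕ
  k = 4 ℕ.+ m

  at : ℕ → Fin k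
  at x = x mod k

  toℕ-at : ∀ {x} → x ℕ.< k → toℕ (at x) ≡ x
  toℕ-at x<k = trans (FinP.toℕ-fromℕ< _) (DivMod.m<n⇒m%n≡m x<k)

  toℕ-at-k : toℕ (at k) ≡ 0
  toℕ-at-k = trans (FinP.toℕ-fromℕ< _) (DivMod.n%n≡0 k)

  at-consecutive : ∀ i → i ℕ.< 3 ℕ.+ m → CycAdj k (at (1 ℕ.+ i)) (at (2 ℕ.+ i))
  at-consecutive i i<3+m with ℕP.m<1+n⇒m<n∨m≡n i<3+m
  ... | inj₁ i<2+m rewrite toℕ-at {1 ℕ.+ i} (ℕP.m<n⇒m<1+n (s≤s i<2+m)) | toℕ-at {2 ℕ.+ i} (s≤s (s≤s i<2+m))
    = inj₁ refl
  ... | inj₂ refl rewrite toℕ-at {3 ℕ.+ m} ℕP.≤-refl | toℕ-at-k = inj₂ (inj₂ (inj₂ (refl , refl)))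

  at-two-apart : ∀ i → suc i ℕ.< 3 ℕ.+ m → at (1 ℕ.+ i) ≢ at (3 ℕ.+ i) × ¬ CycAdj k (at (1 ℕ.+ i)) (at (3 ℕ.+ i))
  at-two-apart i 1+i<3+m with ℕP.m<1+n⇒m<n∨m≡n (ℕ.s≤s⁻¹ 1+i<3+m)
  ... | inj₁ i<1+m = apart ∘ cong toℕ , apart-consecutive
    where
    3+i<k : 3 ℕ.+ i ℕ.< k
    3+i<k = s≤s (s≤s (s≤s i<1+m))
    1+i<k : 1 ℕ.+ i ℕ.< k
    1+i<k = ℕP.m+n≤o⇒n≤o 2 3+i<k
    apart : toℕ (at (1 ℕ.+ i)) ≢ toℕ (at (3 ℕ.+ i))
    apart rewrite toℕ-at 1+i<k | toℕ-at 3+i<k = ℕP.m≢1+n+m (suc i) {1}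
    apart-consecutive : ¬ Consecutive k (toℕ (at (1 ℕ.+ i))) (toℕ (at (3 ℕ.+ i)))
    apart-consecutive rewrite toℕ-at 1+i<k | toℕ-at 3+i<k = λ where
      (inj₁ 2+i≡3+i)                → ℕP.1+n≢n (sym 2+i≡3+i)
      (inj₂ (inj₁ 4+i≡1+i))         → ℕP.m≢1+n+m (suc i) {2} (sym 4+i≡1+i)
      (inj₂ (inj₂ (inj₁ (() , _))))
      (inj₂ (inj₂ (inj₂ (() , _))))
  ... | inj₂ refl = apart ∘ cong toℕ , apart-consecutive
    where
    apart : toℕ (at (2 ℕ.+ m)) ≢ toℕ (at k)
    apart rewrite toℕ-at {2 ℕ.+ m} (ℕP.m+n≤o⇒n≤o 1 ℕP.≤-refl) | toℕ-at-k = λ ()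
    apart-consecutive : ¬ Consecutive k (toℕ (at (2 ℕ.+ m))) (toℕ (at k))
    apart-consecutive rewrite toℕ-at {2 ℕ.+ m} (ℕP.m+n≤o⇒n≤o 1 ℕP.≤-refl) | toℕ-at-k = λ where
      (inj₂ (inj₂ (inj₂ (_ , 4+m≡3+m)))) → ℕP.1+n≢n (sym 4+m≡3+m)

  at-outside-hub : ∀ {x} → 2 ≤ x → x ℕ.< k → ¬ IsV1orV2 (at x)
  at-outside-hub 2≤x x<k = outside 2≤x ∘ Sum.map (trans (sym (toℕ-at x<k))) (trans (sym (toℕ-at x<k)))
    where
    outside : ∀ {x} → 2 ≤ x → ¬ (x ≡ 0 ⊎ x ≡ 1)
    outside (s≤s (s≤s _)) (inj₁ ())
    outside (s≤s (s≤s _)) (inj₂ ())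

module F5Representation (m : ℕ) (rep : ContactB0VPGRep (F5V (4 ℕ.+ m)) (F5Adj (4 ℕ.+ m))) where
  open Cycle m public
  open ContactB0VPGRep rep
  open Representation rep

  cyc-≢ : ∀ {i j : Fin k} → i ≢ j → cyc i ≢ cyc j
  cyc-≢ i≢j refl = i≢j refl

  cycAdj⇒≢ : ∀ {i j} → CycAdj k i j → i ≢ j
  cycAdj⇒≢ adj refl = consecutive-irreflexive adj

  triangle : Fin k → Vec (F5V k) 4
  triangle i = cyc i ∷ tri i Fin.zero ∷ tri i (Fin.suc Fin.zero) ∷ tri i (Fin.suc (Fin.suc Fin.zero)) ∷ []

  triangle-clique : ∀ i → Clique (triangle i)
  triangle-clique i =
      (((λ ()) , refl) ∷ ((λ ()) , refl) ∷ ((λ ()) , refl) ∷ [])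
    ∷ (((λ ()) , refl , λ ()) ∷ ((λ ()) , refl , λ ()) ∷ [])
    ∷ (((λ ()) , refl , λ ()) ∷ [])
    ∷ [] ∷ []

  corner : Fin k → GridPoint
  corner i = proj₁ (clique⇒all-through-point (triangle-clique i))

  corner-on : ∀ i → All (OnSeg (corner i)) (map segOf (triangle i))
  corner-on i = proj₂ (clique⇒all-through-point (triangle-clique i))

  corner-endpoint : ∀ i → IsEndpoint (corner i) (segOf (cyc i))
  corner-endpoint i = clique-point-endpoint (triangle-clique i) ℕP.≤-refl (corner-on i)

  corner-private : ∀ {i w} → w ≢ cyc i → (∀ a → w ≢ tri i a) → ¬ OnSeg (corner i) (segOf w)
  corner-private {i} w≢v w≢t = clique-point-private (AllPairs.map proj₁ (triangle-clique i)) ℕP.≤-refl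
    (corner-on i) (w≢v ∷ w≢t _ ∷ w≢t _ ∷ w≢t _ ∷ [])

  i₀ i₁ : Fin k
  i₀ = Fin.zero
  i₁ = Fin.suc Fin.zero

  hub-clique : Clique (cyc i₀ ∷ cyc i₁ ∷ s ∷ s' ∷ [])
  hub-clique =
      (((λ ()) , inj₁ refl) ∷ ((λ ()) , inj₁ refl) ∷ ((λ ()) , inj₁ refl) ∷ [])
    ∷ (((λ ()) , inj₂ refl) ∷ ((λ ()) , inj₂ refl) ∷ [])
    ∷ (((λ ()) , tt) ∷ [])
    ∷ [] ∷ []

  hub-clique′ : Clique (cyc i₁ ∷ cyc i₀ ∷ s ∷ s' ∷ [])
  hub-clique′ =
      (((λ ()) , inj₂ (inj₁ refl)) ∷ ((λ ()) , inj₂ refl) ∷ ((λ ()) , inj₂ refl) ∷ [])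
    ∷ (((λ ()) , inj₁ refl) ∷ ((λ ()) , inj₁ refl) ∷ [])
    ∷ (((λ ()) , tt) ∷ [])
    ∷ [] ∷ []

  hub : GridPoint
  hub = proj₁ (clique⇒all-through-point hub-clique)

  hub-on : All (OnSeg hub) (map segOf (cyc i₀ ∷ cyc i₁ ∷ s ∷ s' ∷ []))
  hub-on = proj₂ (clique⇒all-through-point hub-clique)

  hub-private : ∀ {w} → w ≢ cyc i₀ → w ≢ cyc i₁ → w ≢ s → w ≢ s' → ¬ OnSeg hub (segOf w)
  hub-private w≢i₀ w≢i₁ w≢s w≢s' = clique-point-private (AllPairs.map proj₁ hub-clique) ℕP.≤-refl hub-on
    (w≢i₀ ∷ w≢i₁ ∷ w≢s ∷ w≢s' ∷ [])

  hub-endpoint-not-corner : ∀ {i} → IsV1orV2 i → IsEndpoint hub (segOf (cyc i)) × hub ≢ corner i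
  hub-endpoint-not-corner {i} (inj₁ i≡0) with FinP.toℕ-injective {i = i} {j = i₀} i≡0 | hub-on
  ... | refl | _ ∷ hub∈i₁ ∷ _ =
    clique-point-endpoint hub-clique ℕP.≤-refl hub-on ,
    λ hub≡c → corner-private (λ ()) (λ _ ()) (subst (λ p → OnSeg p (segOf (cyc i₁))) hub≡c hub∈i₁)
  hub-endpoint-not-corner {i} (inj₂ i≡1) with FinP.toℕ-injective {i = i} {j = i₁} i≡1 | hub-on
  ... | refl | hub∈i₀ ∷ hub∈i₁ ∷ hub∈ss′ =
    clique-point-endpoint hub-clique′ ℕP.≤-refl (hub∈i₁ ∷ hub∈i₀ ∷ hub∈ss′) ,
    λ hub≡c → corner-private (λ ()) (λ _ ()) (subst (λ p → OnSeg p (segOf (cyc i₀))) hub≡c hub∈i₀)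

  Reaches : Fin k → Fin k → Set
  Reaches i j = i ≢ j × ∃ λ p → IsEndpoint p (segOf (cyc i)) × p ≢ corner i × OnSeg p (segOf (cyc j))

  free-end-unique : ∀ {i p q} → IsEndpoint p (segOf (cyc i)) → p ≢ corner i →
                    IsEndpoint q (segOf (cyc i)) → q ≢ corner i → p ≡ q
  free-end-unique {i} p∂ p≢c q∂ q≢c = endpoint-other-than-unique p∂ q∂ (corner-endpoint i) p≢c q≢c

  adjacent-reaches : ∀ {i j} → CycAdj k i j → Reaches i j ⊎ Reaches j i
  adjacent-reaches {i} {j} adj with adj→touch (cyc i) (cyc j) (cyc-≢ (cycAdj⇒≢ adj)) adj
  ... | p , p∈i , p∈j , inj₁ p∂i = inj₁ (cycAdj⇒≢ adj , p , p∂i ,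
    (λ { refl → corner-private (cyc-≢ (cycAdj⇒≢ adj ∘ sym)) (λ _ ()) p∈j }) , p∈j)
  ... | p , p∈i , p∈j , inj₂ p∂j = inj₂ (cycAdj⇒≢ adj ∘ sym , p , p∂j ,
    (λ { refl → corner-private (cyc-≢ (cycAdj⇒≢ adj)) (λ _ ()) p∈i }) , p∈i)

  reaches-both⇒adjacent : ∀ {j a b} → Reaches j a → Reaches j b → a ≢ b → CycAdj k a b
  reaches-both⇒adjacent {j} {a} {b} (j≢a , p , p∂j , p≢c , p∈a) (j≢b , q , q∂j , q≢c , q∈b) a≢b
    with free-end-unique p∂j p≢c q∂j q≢c
  ... | refl = touch→adj (cyc a) (cyc b) (cyc-≢ a≢b) (p , p∈a , q∈b ,
    endpoint-of-one (disjoint _ _ (cyc-≢ a≢b)) (disjoint _ _ (cyc-≢ (j≢a ∘ sym))) (disjoint _ _ (cyc-≢ (j≢b ∘ sym)))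
      p∈a q∈b (endpoint⇒onSeg p∂j))

  hub-reaches-only-hub : ∀ {i w} → IsV1orV2 i → ¬ IsV1orV2 w → ¬ Reaches i w
  hub-reaches-only-hub i∈hub w∉hub (_ , p , p∂i , p≢c , p∈w) with hub-endpoint-not-corner i∈hub
  ... | hub∂i , hub≢c with free-end-unique p∂i p≢c hub∂i hub≢c
  ... | refl = hub-private (cyc-≢ (w∉hub ∘ inj₁ ∘ cong toℕ)) (cyc-≢ (w∉hub ∘ inj₂ ∘ cong toℕ)) (λ ()) (λ ()) p∈w

lemma16 : (k : ℕ) → 4 ≤ k → 2 ∣ k → ¬ IsContactB0VPG (F5V k) (F5Adj k)
lemma16 (suc (suc (suc (suc m)))) (s≤s (s≤s (s≤s (s≤s _)))) _ rep =
  hub-reaches-only-hub (inj₁ toℕ-at-k) (at-outside-hub (s≤s (s≤s z≤n)) ℕP.≤-refl) last-reaches-previous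
  where
  open F5Representation m rep

  _⇝_ : ℕ → ℕ → Set
  i ⇝ j = Reaches (at (suc i)) (at (suc j))

  last-reaches-previous : (3 ℕ.+ m) ⇝ (2 ℕ.+ m)
  last-reaches-previous = edges-point-backward _⇝_
    (λ i i<3+m → adjacent-reaches (at-consecutive i i<3+m))
    (λ i 1+i<3+m back forward →
      let a≢b , ¬adj = at-two-apart i 1+i<3+m in ¬adj (reaches-both⇒adjacent back forward a≢b))
    (hub-reaches-only-hub (inj₂ (toℕ-at (s≤s (s≤s z≤n)))) (at-outside-hub ℕP.≤-refl (s≤s (s≤s (s≤s z≤n)))))
    (2 ℕ.+ m) ℕP.≤-refl
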